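{- Let $C_{10}=0.123456789101112\ldots$ be Champernowne's constant and let $D_{10}$ be the real number whose decimal expansion is obtained from that of $C_{10}$ by replacing every maximal binary run (see context) $r$ by the word $0^{0_r}1^{1_r}$ (the lexicographic sorting of $r$). Let $v$ be a word occurring at some fixed position in the decimal expansion of $C_{10}$ and containing at least one non-binary digit (a digit in $\{2,\dots,9\}$). Write $v=c_1\,u\,c_2$, where $c_1$ is the longest (possibly empty) prefix of $v$ consisting only of binary digits and $c_2$ is the longest (possibly empty) suffix of $v$ consisting only of binary digits. Let $d_1$ (resp. $d_2$) be the maximal binary run of $C_{10}$ containing this occurrence of $c_1$ (resp. $c_2$), taken to be empty if $c_1$ (resp. $c_2$) is empty. Let $\sigma(c_1)$ and $\sigma(c_2)$ denote the words of the same lengths occupying the same positions in the decimal expansion of $D_{10}$. Then $$0_{\sigma(c_1)}=\ell(c_1)-\min\{1_{d_1},\ell(c_1)\},\qquad 1_{\sigma(c_1)}=\min\{1_{d_1},\ell(c_1)\},$$ $$0_{\sigma(c_2)}=\min\{0_{d_2},\ell(c_2)\},\qquad 1_{\sigma(c_2)}=\ell(c_2)-\min\{0_{d_2},\ell(c_2)\}.$$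
   Context: Digits of a decimal expansion are indexed by positions $1,2,3,\dots$ past the decimal point; a word is a finite block of consecutive digits. Digits $0$ and $1$ are called binary digits. A maximal binary run of a decimal expansion is a nonempty block of consecutive binary digits that cannot be extended on either side by a binary digit; every binary digit lies in exactly one maximal binary run. For a word $E$, $\ell(E)$ is its length and, for a digit $c$, $c_E$ denotes the number of occurrences of $c$ in $E$. -}

module Defs where

open import Data.Nat using (ℕ; zero; suc; _+_; _∸_; _≤_; _<_; _≤?_; _<ᵇ_)
open import Data.Nat.Properties using (_≟_)
open import Data.List using (List; []; _∷_; map; concatMap; filter; length; takeWhile; reverse; applyUpTo)
open import Data.Digit using (toNatDigits)
open import Data.Bool using (if_then_else_)
open import Data.Product using (_×_)
open import Data.Sum using (_⊎_)
open import Relation.Nullary using (¬_)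
open import Relation.Binary.PropositionalEquality using (_≡_)

nth : List ℕ → ℕ → ℕ
nth []       _       = 0
nth (x ∷ xs) zero    = x
nth (x ∷ xs) (suc i) = nth xs i

-- decimal digits of n, most significant first (toNatDigits 10 12 = 1 ∷ 2 ∷ [])
decDigits : ℕ → List ℕ
decDigits = toNatDigits 10

champPrefix : ℕ → List ℕ
champPrefix n = concatMap decDigits (applyUpTo suc n)

-- C p = digit of Champernowne's constant C₁₀ at position p (p = 1, 2, 3, ...).
-- The first p integers contribute at least p digits, so this is the p-th digit.
-- (The value at the meaningless position 0 is irrelevant.)
C : ℕ → ℕ
C p = nth (champPrefix p) (p ∸ 1)

Binary : ℕ → Set
Binary d = d ≤ 1

word : (ℕ → ℕ) → ℕ → ℕ → List ℕ
word x s L = applyUpTo (λ i → x (s + i)) L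

occ : ℕ → List ℕ → ℕ
occ c w = length (filter (_≟ c) w)

MaxRun : (ℕ → ℕ) → ℕ → ℕ → Set
MaxRun x a b =
  1 ≤ a × a ≤ b
  × (∀ p → a ≤ p → p ≤ b → Binary (x p))
  × (a ≡ 1 ⊎ ¬ Binary (x (a ∸ 1)))
  × ¬ Binary (x (suc b))

runWord : (ℕ → ℕ) → ℕ → ℕ → List ℕ
runWord x a b = word x a (suc b ∸ a)

-- D is the expansion obtained from C by replacing every maximal binary run r
-- by 0^{0_r} 1^{1_r}: non-binary digits are kept, and inside a run a..b the
-- first 0_r positions become 0 and the remaining ones become 1.
IsD : (ℕ → ℕ) → Set
IsD D =
  (∀ p → 1 ≤ p → ¬ Binary (C p) → D p ≡ C p)
  × (∀ a b p → MaxRun C a b → a ≤ p → p ≤ b →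
       D p ≡ (if p <ᵇ a + occ 0 (runWord C a b) then 0 else 1))

binPrefix : List ℕ → List ℕ
binPrefix = takeWhile (_≤? 1)

binSuffix : List ℕ → List ℕ
binSuffix w = reverse (binPrefix (reverse w))

-- A maximal binary run r is replaced by the sorted word 0^{0_r} 1^{1_r}, so
-- inside r the new digits are 0 up to a threshold and 1 after it.  The binary
-- prefix c₁ of v ends exactly where its run d₁ ends (it is followed by a
-- non-binary digit), so σ(c₁) is the tail of the sorted run and consists of the
-- last min(1_{d₁}, ℓ(c₁)) ones preceded by zeros.  Symmetrically the binary
-- suffix c₂ starts exactly where its run d₂ starts, so σ(c₂) is a head of the
-- sorted run: min(0_{d₂}, ℓ(c₂)) zeros followed by ones.
module Submission where

open import Defs
open import Data.Nat using (ℕ; zero; suc; _+_; _∸_; _≤_; _<_; _⊓_; _<ᵇ_; _≤?_; z≤n; s≤s; z<s; s<s)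
open import Data.Nat.Properties
open import Data.List using ([]; _∷_; _++_; length; reverse; applyUpTo)
open import Data.List.Properties using (applyUpTo-∷ʳ; reverse-++; length-reverse)
open import Data.List.Relation.Unary.Any using (Any; here; there)
open import Data.List.Relation.Unary.Any.Properties using (++⁻)
open import Data.Product using (_×_; _,_; Σ; proj₁; proj₂)
open import Data.Sum using (inj₁; inj₂)
open import Data.Bool using (if_then_else_)
open import Function using (_∘_)
open import Data.Empty using (⊥-elim)
open import Relation.Nullary using (¬_; yes; no)
open import Relation.Binary.PropositionalEquality
open import Relation.Binary.Definitions using (tri<; tri≈; tri>)

∸-from-+ : ∀ {m n o} → m + n ≡ o → o ∸ n ≡ m × o ∸ m ≡ n
∸-from-+ {m} {n} refl = m+n∸n≡m m n , m+n∸m≡n m n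

[m∸n]⊓o+p⊓o≡o : ∀ m n p o → m + p ≡ n + o → (m ∸ n) ⊓ o + p ⊓ o ≡ o
[m∸n]⊓o+p⊓o≡o m       zero    p o refl = cong₂ _+_ (m≤n⇒m⊓n≡m (m≤m+n m p)) (m≤n⇒m⊓n≡m (m≤n+m p m))
[m∸n]⊓o+p⊓o≡o zero    (suc n) p o refl = m≥n⇒m⊓n≡n (m≤n+m o (suc n))
[m∸n]⊓o+p⊓o≡o (suc m) (suc n) p o eq   = [m∸n]⊓o+p⊓o≡o m n p o (suc-injective eq)

+-<ᵇ-∸ : ∀ m n i → (m + i <ᵇ n) ≡ (i <ᵇ n ∸ m)
+-<ᵇ-∸ zero    n       i = refl
+-<ᵇ-∸ (suc m) zero    i = refl
+-<ᵇ-∸ (suc m) (suc n) i = +-<ᵇ-∸ m n i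

applyUpTo-cong-< : ∀ (f g : ℕ → ℕ) n → (∀ i → i < n → f i ≡ g i) → applyUpTo f n ≡ applyUpTo g n
applyUpTo-cong-< f g zero    _  = refl
applyUpTo-cong-< f g (suc n) eq =
  cong₂ _∷_ (eq 0 z<s) (applyUpTo-cong-< (f ∘ suc) (g ∘ suc) n (λ i i<n → eq (suc i) (s<s i<n)))

sortedDigit : ℕ → ℕ → ℕ
sortedDigit m i = if i <ᵇ m then 0 else 1

occ-sortedWord : ∀ m k → occ 0 (applyUpTo (sortedDigit m) k) ≡ m ⊓ k
                       × occ 1 (applyUpTo (sortedDigit m) k) ≡ k ∸ (m ⊓ k)
occ-sortedWord m       zero    = sym (⊓-zeroʳ m) , sym (0∸n≡0 (m ⊓ 0))
occ-sortedWord zero    (suc k) with occ-sortedWord zero k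
... | zeros , ones = zeros , cong suc ones
occ-sortedWord (suc m) (suc k) with occ-sortedWord m k
... | zeros , ones = cong suc zeros , ones

occ-binaryWord : ∀ f n → (∀ i → i < n → Binary (f i)) →
                 occ 0 (applyUpTo f n) + occ 1 (applyUpTo f n) ≡ n
occ-binaryWord f zero    _    = refl
occ-binaryWord f (suc n) bins with f 0 | bins 0 z<s
                                 | occ-binaryWord (f ∘ suc) n (λ i i<n → bins (suc i) (s<s i<n))
... | .0 | z≤n       | ih = cong suc ih
... | .1 | s≤s z≤n   | ih = trans (+-suc _ _) (cong suc ih)

SortsRuns : (ℕ → ℕ) → (ℕ → ℕ) → Set
SortsRuns x y = ∀ a b p → MaxRun x a b → a ≤ p → p ≤ b → y p ≡ sortedDigit (a + occ 0 (runWord x a b)) p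

BinaryBlock : (ℕ → ℕ) → ℕ → ℕ → Set
BinaryBlock x p k = ∀ i → i < k → Binary (x (p + i))

binaryBlock-binary : ∀ {x p k q} → BinaryBlock x p k → p ≤ q → q < p + k → Binary (x q)
binaryBlock-binary {x} {p} {k} {q} bins p≤q q<p+k =
  subst (Binary ∘ x) (m+[n∸m]≡n p≤q)
        (bins (q ∸ p) (+-cancelˡ-< p (q ∸ p) k (subst (_< p + k) (sym (m+[n∸m]≡n p≤q)) q<p+k)))

occ-runWord : ∀ {x a b} → MaxRun x a b → occ 0 (runWord x a b) + occ 1 (runWord x a b) ≡ suc b ∸ a
occ-runWord {x} {a} {b} (_ , a≤b , bins , _ , _) =
  occ-binaryWord (λ i → x (a + i)) (suc b ∸ a) λ i i<len →
    bins (a + i) (m≤m+n a i) (≤-pred (subst (a + i <_) (m+[n∸m]≡n (m≤n⇒m≤1+n a≤b)) (+-monoʳ-< a i<len)))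

maxRun-end : ∀ {x a b s k} → MaxRun x a b → a ≤ s → s ≤ b →
             ¬ Binary (x (s + k)) → BinaryBlock x s k → suc b ≡ s + k
maxRun-end {x} {b = b} {s = s} {k} (_ , _ , bins , _ , afterEnd) a≤s s≤b notBin block
  with <-cmp (suc b) (s + k)
... | tri< b<s+k _ _ = ⊥-elim (afterEnd (binaryBlock-binary {x} block (m≤n⇒m≤1+n s≤b) b<s+k))
... | tri≈ _ eq _    = eq
... | tri> _ _ s+k<b = ⊥-elim (notBin (bins (s + k) (≤-trans a≤s (m≤m+n s k)) (≤-pred s+k<b)))

maxRun-start : ∀ {x a b P k} → MaxRun x a b → ¬ Binary (x P) → BinaryBlock x (suc P) k →
               a ≤ P + k → P + k ≤ b → a ≡ suc P
maxRun-start {x} {a} {b} {P} {k} (s≤s z≤n , _ , bins , beforeStart , _) notBin block a≤ ≤b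
  with <-cmp a (suc P)
... | tri< a≤P _ _ = ⊥-elim (notBin (bins P (≤-pred a≤P) (≤-trans (m≤m+n P k) ≤b)))
... | tri≈ _ eq _  = eq
... | tri> _ _ P<a with beforeStart
...   | inj₁ refl    = ⊥-elim (n≮0 (≤-pred P<a))
...   | inj₂ notBin′ = ⊥-elim (notBin′ (binaryBlock-binary {x} block (≤-pred P<a) (m≤n⇒m≤1+n a≤)))

word-inRun : ∀ {x y a b s k} → SortsRuns x y → MaxRun x a b → a ≤ s → s + k ≤ suc b →
             word y s k ≡ applyUpTo (sortedDigit (a + occ 0 (runWord x a b) ∸ s)) k
word-inRun {x} {y} {a} {b} {s} {k} sorts run a≤s s+k≤ = applyUpTo-cong-< _ _ k λ i i<k →
  trans (sorts a b (s + i) run (≤-trans a≤s (m≤m+n s i)) (≤-pred (≤-trans (+-monoʳ-< s i<k) s+k≤)))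
        (cong (if_then 0 else 1) (+-<ᵇ-∸ s (a + occ 0 (runWord x a b)) i))

binPrefix-binary : ∀ {d} w → Binary d → binPrefix (d ∷ w) ≡ d ∷ binPrefix w
binPrefix-binary w z≤n       = refl
binPrefix-binary w (s≤s z≤n) = refl

binPrefix-nonBinary : ∀ {d} w → ¬ Binary d → binPrefix (d ∷ w) ≡ []
binPrefix-nonBinary {zero}        w notBin = ⊥-elim (notBin z≤n)
binPrefix-nonBinary {suc zero}    w notBin = ⊥-elim (notBin (s≤s z≤n))
binPrefix-nonBinary {suc (suc _)} w notBin = refl

binPrefix-applyUpTo : ∀ f L → Any (λ d → ¬ Binary d) (applyUpTo f L) →
  let k = length (binPrefix (applyUpTo f L)) in ¬ Binary (f k) × (∀ i → i < k → Binary (f i))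
binPrefix-applyUpTo f (suc L) nonBin with f 0 ≤? 1 | nonBin
... | no notBin | _ rewrite binPrefix-nonBinary (applyUpTo (f ∘ suc) L) notBin = notBin , λ _ ()
... | yes bin   | here notBin = ⊥-elim (notBin bin)
... | yes bin   | there nonBin′ rewrite binPrefix-binary (applyUpTo (f ∘ suc) L) bin
  with binPrefix-applyUpTo (f ∘ suc) L nonBin′
...   | notBin , bins = notBin , λ { zero _ → bin ; (suc i) i<k → bins i (≤-pred i<k) }

reverse-word-suc : ∀ x s L → reverse (word x s (suc L)) ≡ x (s + L) ∷ reverse (word x s L)
reverse-word-suc x s L = begin
  reverse (word x s (suc L))             ≡⟨ cong reverse (sym (applyUpTo-∷ʳ (λ i → x (s + i)) L)) ⟩
  reverse (word x s L ++ x (s + L) ∷ []) ≡⟨ reverse-++ (word x s L) (x (s + L) ∷ []) ⟩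
  x (s + L) ∷ reverse (word x s L)       ∎
  where open ≡-Reasoning

binPrefix-reverse-word : ∀ x s L → Any (λ d → ¬ Binary d) (word x s L) →
  let k = length (binPrefix (reverse (word x s L))) in
  Σ ℕ λ P → s + L ≡ suc P + k × ¬ Binary (x P) × BinaryBlock x (suc P) k
binPrefix-reverse-word x s (suc L) nonBin
  rewrite reverse-word-suc x s L with x (s + L) ≤? 1
                                  | ++⁻ (word x s L) (subst (Any _) (sym (applyUpTo-∷ʳ (λ i → x (s + i)) L)) nonBin)
... | no notBin | _ rewrite binPrefix-nonBinary (reverse (word x s L)) notBin =
  s + L , trans (+-suc s L) (cong suc (sym (+-identityʳ (s + L)))) , notBin , λ _ ()
... | yes bin | inj₂ (here notBin) = ⊥-elim (notBin bin)
... | yes bin | inj₁ nonBin′ rewrite binPrefix-binary (reverse (word x s L)) bin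
  with binPrefix-reverse-word x s L nonBin′
...   | P , s+L≡ , notBin , block =
  P , trans (+-suc s L) (trans (cong suc s+L≡) (sym (+-suc (suc P) _))) , notBin , extended
  where
  extended : BinaryBlock x (suc P) (suc (length (binPrefix (reverse (word x s L)))))
  extended i i<k with m≤n⇒m<n∨m≡n (≤-pred i<k)
  ... | inj₁ i<k′  = block i i<k′
  ... | inj₂ refl  = subst (Binary ∘ x) s+L≡ bin

binSuffix-word : ∀ x s L → Any (λ d → ¬ Binary d) (word x s L) →
  let k = length (binSuffix (word x s L)) in
  Σ ℕ λ P → s + L ≡ suc P + k × ¬ Binary (x P) × BinaryBlock x (suc P) k
binSuffix-word x s L nonBin rewrite length-reverse (binPrefix (reverse (word x s L))) =
  binPrefix-reverse-word x s L nonBin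

occ-prefixImage : ∀ {x y a b s k} → SortsRuns x y → MaxRun x a b → a ≤ s → s ≤ b →
  ¬ Binary (x (s + k)) → BinaryBlock x s k →
  occ 0 (word y s k) ≡ k ∸ (occ 1 (runWord x a b) ⊓ k) × occ 1 (word y s k) ≡ occ 1 (runWord x a b) ⊓ k
occ-prefixImage {x} {y} {a} {b} {s} {k} sorts run a≤s s≤b notBin block =
  subst (λ w → occ 0 w ≡ k ∸ (o ⊓ k) × occ 1 w ≡ o ⊓ k) (sym image)
        ( trans (proj₁ (occ-sortedWord m k)) (sym (proj₁ (∸-from-+ fill)))
        , trans (proj₂ (occ-sortedWord m k)) (proj₂ (∸-from-+ fill)))
  where
  z = occ 0 (runWord x a b)
  o = occ 1 (runWord x a b)
  m = z ∸ (s ∸ a)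
  end : suc b ≡ s + k
  end = maxRun-end run a≤s s≤b notBin block
  -- the run consists of the s ∸ a digits before c₁ followed by c₁ itself
  runLength : z + o ≡ (s ∸ a) + k
  runLength = trans (occ-runWord run) (trans (cong (_∸ a) end) (+-∸-comm k a≤s))
  fill : m ⊓ k + o ⊓ k ≡ k
  fill = [m∸n]⊓o+p⊓o≡o z (s ∸ a) o k runLength
  threshold : a + z ∸ s ≡ m
  threshold = trans (cong (a + z ∸_) (sym (m+[n∸m]≡n a≤s))) ([m+n]∸[m+o]≡n∸o a z (s ∸ a))
  image : word y s k ≡ applyUpTo (sortedDigit m) k
  image = trans (word-inRun sorts run a≤s (≤-reflexive (sym end)))
                (cong (λ t → applyUpTo (sortedDigit t) k) threshold)

occ-suffixImage : ∀ {x y a b P k n} → SortsRuns x y → MaxRun x a b → n ≡ suc P + k →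
  ¬ Binary (x P) → BinaryBlock x (suc P) k → a ≤ n ∸ 1 → n ∸ 1 ≤ b →
  occ 0 (word y (n ∸ k) k) ≡ occ 0 (runWord x a b) ⊓ k × occ 1 (word y (n ∸ k) k) ≡ k ∸ (occ 0 (runWord x a b) ⊓ k)
occ-suffixImage {x} {y} {a} {b} {P} {k} sorts run refl notBin block a≤ ≤b =
  subst (λ w → occ 0 w ≡ z ⊓ k × occ 1 w ≡ k ∸ (z ⊓ k)) (sym image) (occ-sortedWord z k)
  where
  open ≡-Reasoning
  z = occ 0 (runWord x a b)
  start : a ≡ suc P
  start = maxRun-start run notBin block a≤ ≤b
  image : word y (suc P + k ∸ k) k ≡ applyUpTo (sortedDigit z) k
  image = begin
    word y (suc P + k ∸ k) k                      ≡⟨ cong (λ t → word y t k) (m+n∸n≡m (suc P) k) ⟩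
    word y (suc P) k                              ≡⟨ word-inRun sorts run (≤-reflexive start) (s≤s ≤b) ⟩
    applyUpTo (sortedDigit (a + z ∸ suc P)) k     ≡⟨ cong (λ t → applyUpTo (sortedDigit (t + z ∸ suc P)) k) start ⟩
    applyUpTo (sortedDigit (suc P + z ∸ suc P)) k ≡⟨ cong (λ t → applyUpTo (sortedDigit t) k) (m+n∸m≡n (suc P) z) ⟩
    applyUpTo (sortedDigit z) k                   ∎

mainTheorem1 :
    (D : ℕ → ℕ) → IsD D →
    (s L : ℕ) → 1 ≤ s →
    let v  = word C s L
        k₁ = length (binPrefix v)
        k₂ = length (binSuffix v)
    in Any (λ d → ¬ Binary d) v →
       (∀ a b → MaxRun C a b → a ≤ s → s ≤ b →
          let d₁ = runWord C a b
              σ₁ = word D s k₁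
          in occ 0 σ₁ ≡ k₁ ∸ (occ 1 d₁ ⊓ k₁) × occ 1 σ₁ ≡ occ 1 d₁ ⊓ k₁)
       × (∀ a b → MaxRun C a b → a ≤ s + L ∸ 1 → s + L ∸ 1 ≤ b →
          let d₂ = runWord C a b
              σ₂ = word D (s + L ∸ k₂) k₂
          in occ 0 σ₂ ≡ occ 0 d₂ ⊓ k₂ × occ 1 σ₂ ≡ k₂ ∸ (occ 0 d₂ ⊓ k₂))
mainTheorem1 D (_ , sorts) s L _ nonBin = prefixPart , suffixPart
  where
  prefixPart = λ a b run a≤s s≤b →
    let notBin , block = binPrefix-applyUpTo (λ i → C (s + i)) L nonBin
    in occ-prefixImage sorts run a≤s s≤b notBin block
  suffixPart = λ a b run a≤ ≤b →
    let _ , s+L≡ , notBin , block = binSuffix-word C s L nonBin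
    in occ-suffixImage sorts run s+L≡ notBin block a≤ ≤b
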